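{- Let $G$ be a graph, let $N > 1$ be an integer, and let $H = H_0 + H_1 + \dots + H_{c-1}$ be a graph, where $H_0,\dots,H_{c-1}$ are graphs. Suppose there is a sequence $X_0, X_1, \ldots, X_{c\cdot|H|\cdot\log(N)-1}$ of subsets of $V(G)$ such that for every index $i$, the subgraph of $G$ induced by $X_i$ is isomorphic to $H_{i \bmod c}$, and for every $v \in X_i$ there are at most $\log(N)$ indices $j < i$ with $v \in N[X_j]$. Then there exists a set $I \subseteq \{0,1,\ldots, c\cdot|H|\cdot\log(N)-1\}$ such that $\bigcup_{i\in I} X_i$ induces in $G$ a subgraph isomorphic to $H$.
   Context: All graphs are finite, simple and undirected. $G_1 + \dots + G_m$ denotes the graph with vertex set $V(G_1)\cup\dots\cup V(G_m)$ and edge set $E(G_1)\cup\dots\cup E(G_m)$ (here the $H_i$ are the parts of a disjoint union). $|H|$ is the number of vertices of $H$. For $X \subseteq V(G)$, $N[X]$ is the closed neighborhood of $X$ in $G$. Throughout, $\log(x)$ denotes $\lceil \log_2 x \rceil$. -}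

module Defs where

open import Data.Nat using (ℕ; zero; suc; _+_; _*_; _<ᵇ_; _%_; _<_)
open import Data.Nat.DivMod using (m%n<n)
open import Data.Bool using (Bool; true; false; _∧_; _∨_; if_then_else_)
open import Data.Fin using (Fin; toℕ; fromℕ<; splitAt)
open import Data.Sum using (_⊎_; inj₁; inj₂)
open import Data.List using (List; map; foldr)
open import Data.Nat.ListAction using (sum)
open import Data.Bool.ListAction using (any)
open import Data.Fin.Base using ()
open import Data.Product using (Σ; ∃; _×_; _,_)
open import Function.Definitions using (Injective)
open import Function.Bundles using (_⇔_)
open import Relation.Binary.PropositionalEquality using (_≡_; refl)
import Data.List as L
open import Data.Empty using (⊥)

allFin : (n : ℕ) → List (Fin n)
allFin = L.allFin

record Graph : Set where
  field
    size   : ℕ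
    adj    : Fin size → Fin size → Bool
    sym    : ∀ u v → adj u v ≡ adj v u
    irrefl : ∀ v → adj v v ≡ false
open Graph public

∣_∣ᵥ : Graph → ℕ
∣ H ∣ᵥ = size H

-- Disjoint union of two graphs: vertices Fin (m + n), first m from G, rest from H.
sumAdj : (m n : ℕ) → (Fin m → Fin m → Bool) → (Fin n → Fin n → Bool)
       → Fin (m + n) → Fin (m + n) → Bool
sumAdj m n a b x y with splitAt m x | splitAt m y
... | inj₁ x' | inj₁ y' = a x' y'
... | inj₂ x' | inj₂ y' = b x' y'
... | inj₁ _  | inj₂ _  = false
... | inj₂ _  | inj₁ _  = false

_⊕_ : Graph → Graph → Graph
G ⊕ H = record
  { size   = size G + size H
  ; adj    = sumAdj (size G) (size H) (adj G) (adj H)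
  ; sym    = s
  ; irrefl = i
  }
  where
  s : ∀ u v → sumAdj (size G) (size H) (adj G) (adj H) u v
            ≡ sumAdj (size G) (size H) (adj G) (adj H) v u
  s u v with splitAt (size G) u | splitAt (size G) v
  ... | inj₁ x | inj₁ y = sym G x y
  ... | inj₂ x | inj₂ y = sym H x y
  ... | inj₁ _ | inj₂ _ = refl
  ... | inj₂ _ | inj₁ _ = refl
  i : ∀ v → sumAdj (size G) (size H) (adj G) (adj H) v v ≡ false
  i v with splitAt (size G) v
  ... | inj₁ x = irrefl G x
  ... | inj₂ x = irrefl H x

emptyGraph : Graph
emptyGraph = record { size = 0 ; adj = λ () ; sym = λ () ; irrefl = λ () }

⨁ : (c : ℕ) → (Fin c → Graph) → Graph
⨁ zero    Hs = emptyGraph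
⨁ (suc c) Hs = Hs Fin.zero ⊕ ⨁ c (λ k → Hs (Fin.suc k))
  where import Data.Fin as Fin

VSet : Graph → Set
VSet G = Fin (size G) → Bool

inClosedNbhd : (G : Graph) → VSet G → Fin (size G) → Bool
inClosedNbhd G X v = X v ∨ any (λ u → X u ∧ adj G u v) (allFin (size G))

count : {L : ℕ} → (Fin L → Bool) → ℕ
count {L} p = sum (map (λ j → if p j then 1 else 0) (allFin L))

bigUnion : {L : ℕ} (G : Graph) → (Fin L → Bool) → (Fin L → VSet G) → VSet G
bigUnion {L} G I X v = any (λ i → I i ∧ X i v) (allFin L)

InducedIso : (G : Graph) → VSet G → Graph → Set
InducedIso G X H =
  Σ (Fin (size H) → Fin (size G)) λ f →
    Injective _≡_ _≡_ f
    × (∀ v → (X v ≡ true) ⇔ (∃ λ a → f a ≡ v))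
    × (∀ a b → adj H a b ≡ adj G (f a) (f b))

-- i mod c, for an index i < c * k (so c ≠ 0 whenever such i exists)
modIdx : (c k : ℕ) → Fin (c * k) → Fin c
modIdx zero    k ()
modIdx (suc c) k i = fromℕ< (m%n<n (toℕ i) (suc c))

module Submission where

-- Say that i blocks j when j < i and X_i meets N[X_j]. Scan the indices from the top down and
-- keep an index when its class i mod c has no representative yet and no representative kept
-- so far blocks it. The representatives are pairwise disjoint and non-adjacent, so their union
-- induces H. By the hypothesis an index i blocks at most |X_i| log N = |H_(i mod c)| log N
-- indices. If a class k were left without a representative, each of its |H| log N members
-- would be blocked by a representative of another class, and these block at most
-- (|H| - |H_k|) log N indices: too few when H_k is nonempty, while if H_k is empty the members
-- of class k cannot be blocked at all.

open import Defs hiding (sym)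
open import Data.Nat using (ℕ; zero; suc; _+_; _*_; _<_; _≤_; _<ᵇ_; _%_; z≤n; s≤s; _≤‴_; ≤‴-refl; ≤‴-step)
open import Data.Nat.Properties
  using (≤-refl; ≤-trans; ≤-reflexive; <-irrefl; <⇒≤; <⇒≱; <-cmp; m≤n+m; m≤m+n; +-mono-≤; +-monoʳ-≤;
         +-monoˡ-≤; +-assoc; +-comm; +-suc; *-suc; *-distribʳ-+; *-mono-≤; m≤n⇒m<n∨m≡n; ≤‴⇒≤; 0≤‴n;
         n≢0⇒n>0)
import Data.Nat.Properties as ℕ
open import Data.Nat.DivMod using ([m+n]%n≡m%n; m<n⇒m%n≡m)
open import Data.Nat.Logarithm using (⌈log₂_⌉; ⌈log₂⌉-mono-≤; ⌈log₂2^n⌉≡n)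
open import Data.Nat.ListAction using (sum)
open import Data.Bool using (Bool; true; false; _∧_; _∨_; if_then_else_)
open import Data.Bool.Properties using (∨-zeroʳ; T-≡)
open import Data.Bool.ListAction using (any)
open import Data.Fin using (Fin; toℕ; zero; suc; fromℕ<; splitAt; join; _↑ˡ_; _↑ʳ_)
open import Data.Fin.Properties
  using (_≟_; suc-injective; toℕ-injective; toℕ-fromℕ<; toℕ<n; splitAt-↑ˡ; splitAt-↑ʳ; join-splitAt)
open import Data.List using (List; []; _∷_; map; length)
open import Data.List.Properties using (map-tabulate; map-cong; length-tabulate)
open import Data.List.Membership.Propositional using (_∈_)
open import Data.List.Membership.Propositional.Properties using (∈-allFin)
open import Data.List.Relation.Unary.Any using (here; there)
open import Data.Maybe using (Maybe; just; nothing)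
open import Data.Product using (Σ; ∃; _×_; _,_; proj₁; proj₂)
open import Data.Sum using (_⊎_; inj₁; inj₂; [_,_]′)
open import Data.Empty using (⊥; ⊥-elim)
open import Data.Vec.Functional using (updateAt)
open import Data.Vec.Functional.Properties using (updateAt-updates; updateAt-minimal)
open import Function using (id; _∘_; case_of_)
open import Function.Bundles using (_⇔_; mk⇔; Equivalence)
open import Function.Definitions using (Injective)
open import Relation.Nullary using (yes; no; does)
open import Relation.Nullary.Decidable using (dec-true; does-⇔)
open import Relation.Binary.Definitions using (tri<; tri≈; tri>)
open import Relation.Binary.PropositionalEquality
  using (_≡_; _≢_; refl; sym; trans; cong; subst; module ≡-Reasoning)

private
  variable
    A B : Set

∧-true : ∀ {a b} → a ∧ b ≡ true → a ≡ true × b ≡ true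
∧-true {true} b≡true = refl , b≡true

∧-intro : ∀ {a b} → a ≡ true → b ≡ true → a ∧ b ≡ true
∧-intro refl b≡true = b≡true

∨-false : ∀ {a b} → a ∨ b ≡ false → a ≡ false × b ≡ false
∨-false {false} b≡false = refl , b≡false

≟-sound : ∀ {n} {x y : Fin n} → does (x ≟ y) ≡ true → x ≡ y
≟-sound {x = x} {y} _ with x ≟ y
... | yes x≡y = x≡y

any-witness : (p : A → Bool) (xs : List A) → any p xs ≡ true → ∃ λ x → p x ≡ true
any-witness p (x ∷ xs) h with p x in px
... | true  = x , px
... | false = any-witness p xs h

any-∈ : (p : A → Bool) {x : A} {xs : List A} → x ∈ xs → p x ≡ true → any p xs ≡ true
any-∈ p (here refl) px rewrite px = refl
any-∈ p {xs = y ∷ ys} (there x∈ys) px with p y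
... | true  = refl
... | false = any-∈ p x∈ys px

any-allFin : ∀ {n} (p : Fin n → Bool) x → p x ≡ true → any p (allFin n) ≡ true
any-allFin p x = any-∈ p (∈-allFin x)

any-allFin-false : ∀ {n} (p : Fin n → Bool) → any p (allFin n) ≡ false → ∀ x → p x ≡ false
any-allFin-false p none x with p x in px
... | false = refl
... | true  with () ← trans (sym none) (any-allFin p x px)

any-const-false : (xs : List A) → any (λ _ → false) xs ≡ false
any-const-false []       = refl
any-const-false (_ ∷ xs) = any-const-false xs

map-allFin-suc : ∀ {n} (f : Fin (suc n) → A) → map f (allFin (suc n)) ≡ f zero ∷ map (f ∘ suc) (allFin n)
map-allFin-suc f = trans (map-tabulate id f) (cong (f zero ∷_) (sym (map-tabulate id (f ∘ suc))))

-- count {n} p is definitionally countList p (allFin n).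
countList : (A → Bool) → List A → ℕ
countList p xs = sum (map (λ x → if p x then 1 else 0) xs)

countList-mono : (p q : A → Bool) (xs : List A) → (∀ x → p x ≡ true → q x ≡ true)
  → countList p xs ≤ countList q xs
countList-mono p q []       p⇒q = z≤n
countList-mono p q (x ∷ xs) p⇒q with p x in px
... | true rewrite p⇒q x px = s≤s (countList-mono p q xs p⇒q)
... | false = ≤-trans (countList-mono p q xs p⇒q) (m≤n+m _ _)

countList-false : (xs : List A) → countList (λ _ → false) xs ≡ 0
countList-false []       = refl
countList-false (_ ∷ xs) = countList-false xs

countList-witness : (p : A → Bool) (xs : List A) → 0 < countList p xs → ∃ λ x → p x ≡ true
countList-witness p (x ∷ xs) pos with p x in px
... | true  = x , px
... | false = countList-witness p xs pos

countList-∨ : (p q : A → Bool) (xs : List A)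
  → countList (λ x → p x ∨ q x) xs ≤ countList p xs + countList q xs
countList-∨ p q []       = z≤n
countList-∨ p q (x ∷ xs) with p x | q x
... | true  | _     = s≤s (≤-trans (countList-∨ p q xs) (+-monoʳ-≤ (countList p xs) (m≤n+m _ _)))
... | false | true  = ≤-trans (s≤s (countList-∨ p q xs)) (≤-reflexive (sym (+-suc _ _)))
... | false | false = countList-∨ p q xs

countList-any : (Q : B → A → Bool) (bs : List B) (xs : List A)
  → countList (λ x → any (λ b → Q b x) bs) xs ≤ sum (map (λ b → countList (Q b) xs) bs)
countList-any Q []       xs = ≤-reflexive (countList-false xs)
countList-any Q (b ∷ bs) xs =
  ≤-trans (countList-∨ (Q b) _ xs) (+-monoʳ-≤ (countList (Q b) xs) (countList-any Q bs xs))

sum-map-mono : (f g : A → ℕ) (xs : List A) → (∀ x → f x ≤ g x) → sum (map f xs) ≤ sum (map g xs)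
sum-map-mono f g []       f≤g = z≤n
sum-map-mono f g (x ∷ xs) f≤g = +-mono-≤ (f≤g x) (sum-map-mono f g xs f≤g)

sum-map-const : (xs : List A) (m : ℕ) → sum (map (λ _ → m) xs) ≡ length xs * m
sum-map-const []       m = refl
sum-map-const (_ ∷ xs) m = cong (m +_) (sum-map-const xs m)

sum-map-gap : (f g : A → ℕ) {x : A} {xs : List A} → x ∈ xs → f x ≡ 0 → (∀ y → f y ≤ g y)
  → sum (map f xs) + g x ≤ sum (map g xs)
sum-map-gap f g {xs = _ ∷ xs} (here refl) fx≡0 f≤g rewrite fx≡0 =
  ≤-trans (≤-reflexive (+-comm (sum (map f xs)) _)) (+-monoʳ-≤ _ (sum-map-mono f g xs f≤g))
sum-map-gap f g {xs = y ∷ _} (there x∈ys) fx≡0 f≤g =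
  ≤-trans (≤-reflexive (+-assoc (f y) _ _)) (+-mono-≤ (f≤g y) (sum-map-gap f g x∈ys fx≡0 f≤g))

sum-sizes-⨁ : ∀ c (Hs : Fin c → Graph) m → sum (map (λ k → size (Hs k) * m) (allFin c)) ≡ size (⨁ c Hs) * m
sum-sizes-⨁ zero    Hs m = refl
sum-sizes-⨁ (suc c) Hs m = begin
  sum (map (λ k → size (Hs k) * m) (allFin (suc c)))
    ≡⟨ cong sum (map-allFin-suc {n = c} (λ k → size (Hs k) * m)) ⟩
  size (Hs zero) * m + sum (map (λ k → size (Hs (suc k)) * m) (allFin c))
    ≡⟨ cong (size (Hs zero) * m +_) (sum-sizes-⨁ c (Hs ∘ suc) m) ⟩
  size (Hs zero) * m + size (⨁ c (Hs ∘ suc)) * m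
    ≡⟨ *-distribʳ-+ m (size (Hs zero)) _ ⟨
  size (⨁ (suc c) Hs) * m
    ∎
  where open ≡-Reasoning

-- Residue classes

countBelow : ℕ → (ℕ → Bool) → ℕ
countBelow zero    P = 0
countBelow (suc n) P = (if P 0 then 1 else 0) + countBelow n (P ∘ suc)

count-toℕ : ∀ n (P : ℕ → Bool) → count {n} (P ∘ toℕ) ≡ countBelow n P
count-toℕ zero    P = refl
count-toℕ (suc n) P =
  trans (cong sum (map-allFin-suc {n = n} (λ j → if P (toℕ j) then 1 else 0)))
        (cong ((if P 0 then 1 else 0) +_) (count-toℕ n (P ∘ suc)))

countBelow-+ : ∀ a b (P : ℕ → Bool) → countBelow (a + b) P ≡ countBelow a P + countBelow b (λ m → P (a + m))
countBelow-+ zero    b P = refl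
countBelow-+ (suc a) b P =
  trans (cong ((if P 0 then 1 else 0) +_) (countBelow-+ a b (P ∘ suc))) (sym (+-assoc (if P 0 then 1 else 0) _ _))

countBelow-cong : ∀ n {P Q : ℕ → Bool} → (∀ m → P m ≡ Q m) → countBelow n P ≡ countBelow n Q
countBelow-cong zero    P≡Q = refl
countBelow-cong (suc n) P≡Q rewrite P≡Q 0 = cong (_ +_) (countBelow-cong n (P≡Q ∘ suc))

countBelow-pos : ∀ n (P : ℕ → Bool) {r} → r < n → P r ≡ true → 0 < countBelow n P
countBelow-pos (suc n) P {zero}  _         Pr rewrite Pr = s≤s z≤n
countBelow-pos (suc n) P {suc r} (s≤s r<n) Pr = ≤-trans (countBelow-pos n (P ∘ suc) r<n Pr) (m≤n+m _ _)

countBelow-periodic : ∀ c L (P : ℕ → Bool) → (∀ m → P (c + m) ≡ P m) → ∀ {r} → r < c → P r ≡ true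
  → L ≤ countBelow (c * L) P
countBelow-periodic c zero    P periodic r<c Pr = z≤n
countBelow-periodic c (suc L) P periodic r<c Pr = begin
  1 + L
    ≤⟨ +-mono-≤ (countBelow-pos c P r<c Pr) (countBelow-periodic c L P periodic r<c Pr) ⟩
  countBelow c P + countBelow (c * L) P
    ≡⟨ cong (countBelow c P +_) (countBelow-cong (c * L) periodic) ⟨
  countBelow c P + countBelow (c * L) (λ m → P (c + m))
    ≡⟨ countBelow-+ c (c * L) P ⟨
  countBelow (c + c * L) P
    ≡⟨ cong (λ n → countBelow n P) (*-suc c L) ⟨
  countBelow (c * suc L) P
    ∎
  where open ℕ.≤-Reasoning

modIdx-class-size : ∀ c L (k : Fin c) → L ≤ count (λ j → does (modIdx c L j ≟ k))
modIdx-class-size c@(suc _) L k = begin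
  L
    ≤⟨ countBelow-periodic c L P periodic (toℕ<n k) (dec-true (toℕ k % c ℕ.≟ toℕ k) (m<n⇒m%n≡m (toℕ<n k))) ⟩
  countBelow (c * L) P
    ≡⟨ count-toℕ (c * L) P ⟨
  count {c * L} (P ∘ toℕ)
    ≡⟨ cong sum (map-cong (λ j → cong (if_then 1 else 0) (class≡residue j)) (allFin (c * L))) ⟨
  count {c * L} (λ j → does (modIdx c L j ≟ k))
    ∎
  where
  open ℕ.≤-Reasoning
  P : ℕ → Bool
  P m = does (m % c ℕ.≟ toℕ k)
  periodic : ∀ m → P (c + m) ≡ P m
  periodic m = cong (λ n → does (n ℕ.≟ toℕ k)) (trans (cong (_% c) (+-comm c m)) ([m+n]%n≡m%n m c))
  class≡residue : ∀ j → does (modIdx c L j ≟ k) ≡ P (toℕ j)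
  class≡residue j = does-⇔
    (mk⇔ (λ e → trans (sym (toℕ-fromℕ< _)) (cong toℕ e)) (λ e → toℕ-injective (trans (toℕ-fromℕ< _) e)))
    (modIdx c L j ≟ k) (toℕ j % c ℕ.≟ toℕ k)

-- Induced subgraphs

module _ (G : Graph) where

  meets : VSet G → VSet G → Bool
  meets Y Z = any (λ v → Z v ∧ inClosedNbhd G Y v) (allFin (size G))

  Separated : VSet G → VSet G → Set
  Separated Y Z = ∀ {u v} → Y u ≡ true → Z v ≡ true → u ≢ v × adj G u v ≡ false

  separated-sym : ∀ {Y Z} → Separated Y Z → Separated Z Y
  separated-sym sep zu yv = (λ u≡v → proj₁ (sep yv zu) (sym u≡v)) , trans (Graph.sym G _ _) (proj₂ (sep yv zu))

  separated-if-not-meets : ∀ {Y Z} → meets Y Z ≡ false → Separated Y Z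
  separated-if-not-meets {Y} {Z} disjoint {u} {v} yu zv = u≢v , adj≡false
    where
    v∉N[Y] : inClosedNbhd G Y v ≡ false
    v∉N[Y] = subst (λ b → b ∧ inClosedNbhd G Y v ≡ false) zv (any-allFin-false _ disjoint v)
    u≢v : u ≢ v
    u≢v refl with () ← trans (sym yu) (proj₁ (∨-false v∉N[Y]))
    adj≡false : adj G u v ≡ false
    adj≡false = subst (λ b → b ∧ adj G u v ≡ false) yu (any-allFin-false _ (proj₂ (∨-false v∉N[Y])) u)

  inClosedNbhd-witness : ∀ {Y v} → inClosedNbhd G Y v ≡ true → ∃ λ u → Y u ≡ true
  inClosedNbhd-witness {Y} {v} v∈N[Y] with Y v in yv
  ... | true  = v , yv
  ... | false = let u , yu∧adj = any-witness (λ u → Y u ∧ adj G u v) (allFin (size G)) v∈N[Y]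
                in u , proj₁ (∧-true yu∧adj)

  not-meets-if-empty : ∀ {Y} → (∀ {u} → Y u ≡ true → ⊥) → ∀ Z → meets Y Z ≡ false
  not-meets-if-empty {Y} Y-empty Z with meets Y Z in m
  ... | false = refl
  ... | true with v , zv∧v∈N[Y] ← any-witness _ (allFin (size G)) m =
    ⊥-elim (Y-empty (proj₂ (inClosedNbhd-witness (proj₂ (∧-true {Z v} zv∧v∈N[Y])))))

  image-⊆ : ∀ {Y H} (Y≅H : InducedIso G Y H) a → Y (proj₁ Y≅H a) ≡ true
  image-⊆ (f , _ , f-img , _) a = Equivalence.from (f-img (f a)) (a , refl)

  count-meets≤ : ∀ {L} (Y : Fin L → VSet G) (P : Fin L → Bool) {Z H} (b : ℕ) → InducedIso G Z H
    → (∀ {v} → Z v ≡ true → count (λ j → P j ∧ inClosedNbhd G (Y j) v) ≤ b)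
    → count (λ j → P j ∧ meets (Y j) Z) ≤ size H * b
  count-meets≤ {L} Y P {Z} {H} b Z≅H@(f , _ , f-img , _) few = begin
    count (λ j → P j ∧ meets (Y j) Z)
      ≤⟨ countList-mono _ _ (allFin L) through-image ⟩
    countList (λ j → any (λ a → Q a j) (allFin (size H))) (allFin L)
      ≤⟨ countList-any Q (allFin (size H)) (allFin L) ⟩
    sum (map (λ a → count (Q a)) (allFin (size H)))
      ≤⟨ sum-map-mono _ _ (allFin (size H)) (λ a → few {f a} (image-⊆ {Z} {H} Z≅H a)) ⟩
    sum (map (λ _ → b) (allFin (size H)))
      ≡⟨ sum-map-const (allFin (size H)) b ⟩
    length (allFin (size H)) * b
      ≡⟨ cong (_* b) (length-tabulate {n = size H} id) ⟩
    size H * b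
      ∎
    where
    open ℕ.≤-Reasoning
    Q : Fin (size H) → Fin L → Bool
    Q a j = P j ∧ inClosedNbhd G (Y j) (f a)
    through-image : ∀ j → P j ∧ meets (Y j) Z ≡ true → any (λ a → Q a j) (allFin (size H)) ≡ true
    through-image j pj∧meets with pj , meets ← ∧-true pj∧meets
                             with v , zv∧v∈N ← any-witness _ (allFin (size G)) meets
                             with a , fa≡v ← Equivalence.to (f-img v) (proj₁ (∧-true {Z v} zv∧v∈N))
      = any-allFin (λ a → Q a j) a
          (∧-intro pj (subst (λ x → inClosedNbhd G (Y j) x ≡ true) (sym fa≡v) (proj₂ (∧-true {Z v} zv∧v∈N))))

  InducedIso-resp : ∀ {Y Z H} → (∀ {v} → Y v ≡ true → Z v ≡ true) → (∀ {v} → Z v ≡ true → Y v ≡ true)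
    → InducedIso G Y H → InducedIso G Z H
  InducedIso-resp Y⊆Z Z⊆Y (f , f-inj , f-img , f-adj) =
    f , f-inj , (λ v → mk⇔ (Equivalence.to (f-img v) ∘ Z⊆Y) (Y⊆Z ∘ Equivalence.from (f-img v))) , f-adj

  InducedIso-empty : ∀ {Y H} → size H ≡ 0 → (∀ v → Y v ≡ false) → InducedIso G Y H
  InducedIso-empty {Y} {H} size≡0 Y-empty =
    f , (λ {a} → ⊥-elim (no-vertex a)) , f-img , (λ a → ⊥-elim (no-vertex a))
    where
    no-vertex : Fin (size H) → ⊥
    no-vertex a with () ← subst Fin size≡0 a
    f : Fin (size H) → Fin (size G)
    f a = ⊥-elim (no-vertex a)
    f-img : ∀ v → (Y v ≡ true) ⇔ (∃ λ a → f a ≡ v)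
    f-img v = mk⇔ (λ yv → case trans (sym (Y-empty v)) yv of λ ()) (λ (a , _) → ⊥-elim (no-vertex a))

  ⊕-induced : ∀ {Y Z H₁ H₂} → InducedIso G Y H₁ → InducedIso G Z H₂ → Separated Y Z
    → InducedIso G (λ v → Y v ∨ Z v) (H₁ ⊕ H₂)
  ⊕-induced {Y} {Z} {H₁} {H₂} Y≅H₁@(f , f-inj , f-img , f-adj) Z≅H₂@(g , g-inj , g-img , g-adj) sep =
    h , h-inj , h-img , h-adj
    where
    h : Fin (size H₁ + size H₂) → Fin (size G)
    h = [ f , g ]′ ∘ splitAt (size H₁)
    cross : ∀ a b → f a ≢ g b × adj G (f a) (g b) ≡ false
    cross a b = sep (image-⊆ {Y} {H₁} Y≅H₁ a) (image-⊆ {Z} {H₂} Z≅H₂ b)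
    [f,g]-inj : Injective _≡_ _≡_ [ f , g ]′
    [f,g]-inj {inj₁ a} {inj₁ a′} e = cong inj₁ (f-inj e)
    [f,g]-inj {inj₁ a} {inj₂ b}  e = ⊥-elim (proj₁ (cross a b) e)
    [f,g]-inj {inj₂ b} {inj₁ a}  e = ⊥-elim (proj₁ (cross a b) (sym e))
    [f,g]-inj {inj₂ b} {inj₂ b′} e = cong inj₂ (g-inj e)
    h-inj : Injective _≡_ _≡_ h
    h-inj {x} {y} e = begin
      x                               ≡⟨ join-splitAt (size H₁) (size H₂) x ⟨
      join _ _ (splitAt (size H₁) x)  ≡⟨ cong (join _ _) ([f,g]-inj {splitAt (size H₁) x} {splitAt (size H₁) y} e) ⟩
      join _ _ (splitAt (size H₁) y)  ≡⟨ join-splitAt (size H₁) (size H₂) y ⟩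
      y                               ∎
      where open ≡-Reasoning
    h-img : ∀ v → (Y v ∨ Z v ≡ true) ⇔ (∃ λ a → h a ≡ v)
    h-img v = mk⇔ to from
      where
      to : Y v ∨ Z v ≡ true → ∃ λ a → h a ≡ v
      to yv∨zv with Y v in yv
      ... | true  = let a , fa≡v = Equivalence.to (f-img v) yv
                    in a ↑ˡ size H₂ , trans (cong [ f , g ]′ (splitAt-↑ˡ (size H₁) a (size H₂))) fa≡v
      ... | false = let b , gb≡v = Equivalence.to (g-img v) yv∨zv
                    in size H₁ ↑ʳ b , trans (cong [ f , g ]′ (splitAt-↑ʳ (size H₁) (size H₂) b)) gb≡v
      from : (∃ λ a → h a ≡ v) → Y v ∨ Z v ≡ true
      from (a , ha≡v) with splitAt (size H₁) a
      ... | inj₁ a₁ rewrite Equivalence.from (f-img v) (a₁ , ha≡v) = refl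
      ... | inj₂ a₂ rewrite Equivalence.from (g-img v) (a₂ , ha≡v) = ∨-zeroʳ (Y v)
    h-adj : ∀ a b → adj (H₁ ⊕ H₂) a b ≡ adj G (h a) (h b)
    h-adj a b with splitAt (size H₁) a | splitAt (size H₁) b
    ... | inj₁ a₁ | inj₁ b₁ = f-adj a₁ b₁
    ... | inj₁ a₁ | inj₂ b₂ = sym (proj₂ (cross a₁ b₂))
    ... | inj₂ a₂ | inj₁ b₁ = sym (trans (Graph.sym G _ _) (proj₂ (cross b₁ a₂)))
    ... | inj₂ a₂ | inj₂ b₂ = g-adj a₂ b₂

  ⋃ : ∀ {c} → (Fin c → VSet G) → VSet G
  ⋃ {zero}  Y v = false
  ⋃ {suc c} Y v = Y zero v ∨ ⋃ (Y ∘ suc) v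

  ⋃-witness : ∀ {c} (Y : Fin c → VSet G) {v} → ⋃ Y v ≡ true → ∃ λ k → Y k v ≡ true
  ⋃-witness {suc c} Y {v} v∈⋃ with Y zero v in v∈Y₀
  ... | true  = zero , v∈Y₀
  ... | false = let k , v∈Yk = ⋃-witness (Y ∘ suc) v∈⋃ in suc k , v∈Yk

  ⋃-intro : ∀ {c} (Y : Fin c → VSet G) k {v} → Y k v ≡ true → ⋃ Y v ≡ true
  ⋃-intro Y zero    v∈Yk rewrite v∈Yk = refl
  ⋃-intro Y (suc k) {v} v∈Yk rewrite ⋃-intro (Y ∘ suc) k v∈Yk = ∨-zeroʳ (Y zero v)

  ⨁-induced : ∀ c (Hs : Fin c → Graph) (Y : Fin c → VSet G)
    → (∀ k → InducedIso G (Y k) (Hs k)) → (∀ {k k′} → k ≢ k′ → Separated (Y k) (Y k′))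
    → InducedIso G (⋃ Y) (⨁ c Hs)
  ⨁-induced zero    Hs Y Y≅Hs sep = InducedIso-empty {⋃ Y} {emptyGraph} refl (λ _ → refl)
  ⨁-induced (suc c) Hs Y Y≅Hs sep =
    ⊕-induced {Y zero} {⋃ (Y ∘ suc)} {Hs zero} {⨁ c (Hs ∘ suc)} (Y≅Hs zero)
      (⨁-induced c (Hs ∘ suc) (Y ∘ suc) (Y≅Hs ∘ suc) (λ k≢k′ → sep (k≢k′ ∘ suc-injective)))
      (λ yu v∈⋃ → let k , v∈Yk = ⋃-witness (Y ∘ suc) v∈⋃ in sep (λ ()) yu v∈Yk)

  separated-by-rank : ∀ {c} (Y : Fin c → VSet G) (rank : Fin c → ℕ) → (∀ {k k′} → rank k ≡ rank k′ → k ≡ k′)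
    → (∀ {k k′} → rank k < rank k′ → meets (Y k) (Y k′) ≡ false)
    → ∀ {k k′} → k ≢ k′ → Separated (Y k) (Y k′)
  separated-by-rank Y rank rank-inj ordered {k} {k′} k≢k′ with <-cmp (rank k) (rank k′)
  ... | tri< k<k′ _ _ = separated-if-not-meets {Y k} {Y k′} (ordered k<k′)
  ... | tri≈ _ k≡k′ _ = ⊥-elim (k≢k′ (rank-inj k≡k′))
  ... | tri> _ _ k′<k = separated-sym {Y k′} {Y k} (separated-if-not-meets {Y k′} {Y k} (ordered k′<k))

  bigUnion-image : ∀ {c L} (X : Fin L → VSet G) (σ : Fin c → Fin L) {H}
    → InducedIso G (⋃ (X ∘ σ)) H → InducedIso G (bigUnion G (λ i → any (λ k → does (σ k ≟ i)) (allFin c)) X) H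
  bigUnion-image {c} {L} X σ {H} = InducedIso-resp {⋃ (X ∘ σ)} {bigUnion G _ X} {H} ⋃⊆ ⊆⋃
    where
    ⋃⊆ : ∀ {v} → ⋃ (X ∘ σ) v ≡ true → bigUnion G _ X v ≡ true
    ⋃⊆ {v} v∈⋃ = let k , v∈Xσk = ⋃-witness (X ∘ σ) v∈⋃ in
      any-allFin _ (σ k) (∧-intro (any-allFin _ k (dec-true (σ k ≟ σ k) refl)) v∈Xσk)
    ⊆⋃ : ∀ {v} → bigUnion G _ X v ≡ true → ⋃ (X ∘ σ) v ≡ true
    ⊆⋃ {v} v∈⋃ with i , i∈I∧v∈Xi ← any-witness _ (allFin L) v∈⋃
               with i∈I , v∈Xi ← ∧-true i∈I∧v∈Xi
               with k , σk≡i ← any-witness _ (allFin c) i∈I =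
      ⋃-intro (X ∘ σ) k (subst (λ i → X i v ≡ true) (sym (≟-sound σk≡i)) v∈Xi)

-- The greedy transversal

module GreedyTransversal {M c : ℕ} (cls : Fin M → Fin c) (conflict : Fin M → Fin M → Bool) where

  blocks : Fin M → Fin M → Bool
  blocks i j = (toℕ j <ᵇ toℕ i) ∧ conflict j i

  Choice : Set
  Choice = Fin c → Maybe (Fin M)

  blockedBy : Maybe (Fin M) → Fin M → Bool
  blockedBy nothing  j = false
  blockedBy (just i) j = blocks i j

  blocked : Choice → Fin M → Bool
  blocked ch j = any (λ k → blockedBy (ch k) j) (allFin c)

  -- The state of the greedy scan once it has examined, from the top down, the indices ≥ b.
  record GreedyFrom (b : ℕ) (ch : Choice) : Set where
    field
      chosen-in-class    : ∀ {k i} → ch k ≡ just i → cls i ≡ k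
      chosen-≥           : ∀ {k i} → ch k ≡ just i → b ≤ toℕ i
      chosen-independent : ∀ {k k′ i i′} → ch k ≡ just i → ch k′ ≡ just i′ → toℕ i < toℕ i′ → conflict i i′ ≡ false
      unchosen-blocked   : ∀ {j} → b ≤ toℕ j → ch (cls j) ≡ nothing → blocked ch j ≡ true
  open GreedyFrom

  blocked-mono : ∀ {ch ch′} → (∀ {k i} → ch k ≡ just i → ch′ k ≡ just i)
    → ∀ {j} → blocked ch j ≡ true → blocked ch′ j ≡ true
  blocked-mono {ch} {ch′} ch⊆ch′ {j} j-blocked
    with k , by-k ← any-witness (λ k → blockedBy (ch k) j) (allFin c) j-blocked
    with ch k in chk
  ... | just i =
    any-allFin (λ k → blockedBy (ch′ k) j) k (subst (λ m → blockedBy m j ≡ true) (sym (ch⊆ch′ chk)) by-k)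

  blocked-witness : ∀ {ch j} → blocked ch j ≡ true → ∃ λ i → conflict j i ≡ true
  blocked-witness {ch} {j} j-blocked with k , by-k ← any-witness (λ k → blockedBy (ch k) j) (allFin c) j-blocked
                                     with ch k
  ... | just i = i , proj₂ (∧-true by-k)

  ≤-split : ∀ (j j′ : Fin M) → toℕ j ≤ toℕ j′ → j′ ≡ j ⊎ suc (toℕ j) ≤ toℕ j′
  ≤-split j j′ j≤j′ with m≤n⇒m<n∨m≡n j≤j′
  ... | inj₁ j<j′ = inj₂ j<j′
  ... | inj₂ j≡j′ = inj₁ (toℕ-injective (sym j≡j′))

  greedy-start : GreedyFrom M (λ _ → nothing)
  greedy-start = record
    { chosen-in-class    = λ ()
    ; chosen-≥           = λ ()
    ; chosen-independent = λ ()
    ; unchosen-blocked   = λ {j} M≤j _ → ⊥-elim (<⇒≱ (toℕ<n j) M≤j)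
    }

  greedy-skip : ∀ {j ch} → GreedyFrom (suc (toℕ j)) ch → (ch (cls j) ≡ nothing → blocked ch j ≡ true)
    → GreedyFrom (toℕ j) ch
  greedy-skip {j} {ch} g j-blocked = record
    { chosen-in-class    = chosen-in-class g
    ; chosen-≥           = <⇒≤ ∘ chosen-≥ g
    ; chosen-independent = chosen-independent g
    ; unchosen-blocked   = λ {j′} j≤j′ unchosen → case ≤-split j j′ j≤j′ of λ where
        (inj₁ refl) → j-blocked unchosen
        (inj₂ j<j′) → unchosen-blocked g j<j′ unchosen
    }

  take : Fin M → Choice → Choice
  take j ch = updateAt ch (cls j) (λ _ → just j)

  take-chosen : ∀ j ch → take j ch (cls j) ≡ just j
  take-chosen j ch = updateAt-updates (cls j) ch

  take-cases : ∀ {j ch k i} → take j ch k ≡ just i → (k ≡ cls j × i ≡ j) ⊎ ch k ≡ just i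
  take-cases {j} {ch} {k} e with k ≟ cls j
  ... | yes refl with refl ← trans (sym e) (take-chosen j ch) = inj₁ (refl , refl)
  ... | no  k≢j  = inj₂ (trans (sym (updateAt-minimal k (cls j) ch k≢j)) e)

  take-unchosen : ∀ {j ch k} → take j ch k ≡ nothing → ch k ≡ nothing
  take-unchosen {j} {ch} {k} e with k ≟ cls j
  ... | yes refl with () ← trans (sym e) (take-chosen j ch)
  ... | no  k≢j  = trans (sym (updateAt-minimal k (cls j) ch k≢j)) e

  take-extends : ∀ {j ch} → ch (cls j) ≡ nothing → ∀ {k i} → ch k ≡ just i → take j ch k ≡ just i
  take-extends {j} {ch} unchosen {k} chk with k ≟ cls j
  ... | yes refl with () ← trans (sym unchosen) chk
  ... | no  k≢j  = trans (updateAt-minimal k (cls j) ch k≢j) chk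

  greedy-take : ∀ {j ch} → GreedyFrom (suc (toℕ j)) ch → ch (cls j) ≡ nothing → blocked ch j ≡ false
    → GreedyFrom (toℕ j) (take j ch)
  greedy-take {j} {ch} g unchosen unblocked = record
    { chosen-in-class    = in-class
    ; chosen-≥           = ≥j
    ; chosen-independent = independent
    ; unchosen-blocked   = λ {j′} j≤j′ unchosen′ → case ≤-split j j′ j≤j′ of λ where
        (inj₁ refl) → case trans (sym unchosen′) (take-chosen j ch) of λ ()
        (inj₂ j<j′) → blocked-mono (take-extends unchosen) (unchosen-blocked g j<j′ (take-unchosen unchosen′))
    }
    where
    in-class : ∀ {k i} → take j ch k ≡ just i → cls i ≡ k
    in-class e with take-cases e
    ... | inj₁ (refl , refl) = refl
    ... | inj₂ chk           = chosen-in-class g chk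
    ≥j : ∀ {k i} → take j ch k ≡ just i → toℕ j ≤ toℕ i
    ≥j e with take-cases e
    ... | inj₁ (_ , refl) = ≤-refl
    ... | inj₂ chk        = <⇒≤ (chosen-≥ g chk)
    compatible : ∀ {k i} → ch k ≡ just i → conflict j i ≡ false
    compatible {k} {i} chk =
      subst (λ b → b ∧ conflict j i ≡ false) (Equivalence.to T-≡ (ℕ.<⇒<ᵇ (chosen-≥ g chk)))
        (subst (λ m → blockedBy m j ≡ false) chk (any-allFin-false _ unblocked k))
    independent : ∀ {k k′ i i′} → take j ch k ≡ just i → take j ch k′ ≡ just i′ → toℕ i < toℕ i′
      → conflict i i′ ≡ false
    independent e e′ i<i′ with take-cases e | take-cases e′
    ... | inj₁ (_ , refl) | inj₁ (_ , refl) = ⊥-elim (<-irrefl refl i<i′)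
    ... | inj₁ (_ , refl) | inj₂ chk′       = compatible chk′
    ... | inj₂ chk        | inj₁ (_ , refl) = ⊥-elim (<⇒≱ i<i′ (<⇒≤ (chosen-≥ g chk)))
    ... | inj₂ chk        | inj₂ chk′       = chosen-independent g chk chk′ i<i′

  greedy-step : ∀ {b} (j : Fin M) → toℕ j ≡ b → ∀ ch → GreedyFrom (suc b) ch → Σ Choice (GreedyFrom b)
  greedy-step j refl ch g with ch (cls j) in class-chosen | blocked ch j in j-blocked
  ... | just _  | _     = ch , greedy-skip g (λ unchosen → case trans (sym class-chosen) unchosen of λ ())
  ... | nothing | true  = ch , greedy-skip g (λ _ → j-blocked)
  ... | nothing | false = take j ch , greedy-take g class-chosen j-blocked

  greedy : ∀ {b} → b ≤‴ M → Σ Choice (GreedyFrom b)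
  greedy ≤‴-refl       = (λ _ → nothing) , greedy-start
  greedy (≤‴-step b<M) = let ch , g = greedy b<M in greedy-step (fromℕ< (≤‴⇒≤ b<M)) (toℕ-fromℕ< _) ch g

  module _ (D : Fin c → ℕ) (blocks≤ : ∀ i → count (blocks i) ≤ D (cls i)) where

    unchosen-class≤ : ∀ {ch} → GreedyFrom 0 ch → ∀ {k} → ch k ≡ nothing
      → count (λ j → does (cls j ≟ k)) + D k ≤ sum (map D (allFin c))
    unchosen-class≤ {ch} g {k} unchosen = begin
      count (λ j → does (cls j ≟ k)) + D k
        ≤⟨ +-monoˡ-≤ (D k) (countList-mono _ _ (allFin M) class-blocked) ⟩
      count (blocked ch) + D k
        ≤⟨ +-monoˡ-≤ (D k) (countList-any (λ k′ j → blockedBy (ch k′) j) (allFin c) (allFin M)) ⟩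
      sum (map blockedCount (allFin c)) + D k
        ≤⟨ sum-map-gap blockedCount D (∈-allFin k) none-by-k blockedCount≤ ⟩
      sum (map D (allFin c))
        ∎
      where
      open ℕ.≤-Reasoning
      class-blocked : ∀ j → does (cls j ≟ k) ≡ true → blocked ch j ≡ true
      class-blocked j j∈k with refl ← ≟-sound {x = cls j} {k} j∈k = unchosen-blocked g z≤n unchosen
      blockedCount : Fin c → ℕ
      blockedCount k′ = count (blockedBy (ch k′))
      none-by-k : blockedCount k ≡ 0
      none-by-k rewrite unchosen = countList-false (allFin M)
      blockedCount≤ : ∀ k′ → blockedCount k′ ≤ D k′
      blockedCount≤ k′ with ch k′ in chk′
      ... | nothing = subst (_≤ D k′) (sym (countList-false (allFin M))) z≤n
      ... | just i  = subst (λ k″ → count (blocks i) ≤ D k″) (chosen-in-class g chk′) (blocks≤ i)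

    transversal : (∀ k → sum (map D (allFin c)) < D k + count (λ j → does (cls j ≟ k))
                         ⊎ ∃ λ j → cls j ≡ k × ∀ i → conflict j i ≡ false)
      → Σ (Fin c → Fin M) λ σ → (∀ k → cls (σ k) ≡ k)
          × (∀ {k k′} → toℕ (σ k) < toℕ (σ k′) → conflict (σ k) (σ k′) ≡ false)
    transversal viable =
      σ , (λ k → chosen-in-class g (σ-chosen k)) , λ {k} {k′} → chosen-independent g (σ-chosen k) (σ-chosen k′)
      where
      ch = proj₁ (greedy 0≤‴n)
      g  = proj₂ (greedy 0≤‴n)
      chosen : ∀ k → ∃ λ i → ch k ≡ just i
      chosen k with ch k in chk
      ... | just i  = i , refl
      ... | nothing with viable k
      ...   | inj₁ many = ⊥-elim (<⇒≱ many (≤-trans (≤-reflexive (+-comm (D k) _)) (unchosen-class≤ g chk)))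
      ...   | inj₂ (j , refl , free) with i , conflict≡true ← blocked-witness {ch} (unchosen-blocked g z≤n chk)
                                     with () ← trans (sym (free i)) conflict≡true
      σ : Fin c → Fin M
      σ k = proj₁ (chosen k)
      σ-chosen : ∀ k → ch k ≡ just (σ k)
      σ-chosen k = proj₂ (chosen k)

-- The theorem, for an arbitrary positive bound b in place of log N

module _ (G : Graph) {c : ℕ} (Hs : Fin c → Graph) {b : ℕ} (1≤b : 1 ≤ b)
         (X : Fin (c * (∣ ⨁ c Hs ∣ᵥ * b)) → VSet G)
         (X≅Hs : ∀ i → InducedIso G (X i) (Hs (modIdx c (∣ ⨁ c Hs ∣ᵥ * b) i)))
         (sparse : ∀ i v → X i v ≡ true → count (λ j → (toℕ j <ᵇ toℕ i) ∧ inClosedNbhd G (X j) v) ≤ b) where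

  private
    L : ℕ
    L = ∣ ⨁ c Hs ∣ᵥ * b

  open GreedyTransversal (modIdx c L) (λ j i → meets G (X j) (X i))

  blocks≤ : ∀ i → count (blocks i) ≤ size (Hs (modIdx c L i)) * b
  blocks≤ i = count-meets≤ G X (λ j → toℕ j <ᵇ toℕ i) {X i} {Hs (modIdx c L i)} b (X≅Hs i) (sparse i _)

  class-viable : 0 < ∣ ⨁ c Hs ∣ᵥ → ∀ k
    → sum (map (λ k → size (Hs k) * b) (allFin c)) < size (Hs k) * b + count (λ j → does (modIdx c L j ≟ k))
      ⊎ ∃ λ j → modIdx c L j ≡ k × ∀ i → meets G (X j) (X i) ≡ false
  class-viable 0<S k with size (Hs k) in size≡
  ... | suc w = inj₁ (begin-strict
    sum (map (λ k → size (Hs k) * b) (allFin c))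
      ≡⟨ sum-sizes-⨁ c Hs b ⟩
    L
      <⟨ s≤s ≤-refl ⟩
    1 + L
      ≤⟨ +-mono-≤ (≤-trans 1≤b (m≤m+n b (w * b))) (modIdx-class-size c L k) ⟩
    suc w * b + count (λ j → does (modIdx c L j ≟ k))
      ∎)
    where open ℕ.≤-Reasoning
  ... | zero
    with j , j∈k ← countList-witness _ (allFin (c * L)) (≤-trans (*-mono-≤ 0<S 1≤b) (modIdx-class-size c L k))
    = inj₂ (j , ≟-sound j∈k , λ i → not-meets-if-empty G {X j} Xj-empty (X i))
    where
    Xj-empty : ∀ {u} → X j u ≡ true → ⊥
    Xj-empty xu with a , _ ← Equivalence.to (proj₁ (proj₂ (proj₂ (X≅Hs j))) _) xu
                with () ← subst Fin size≡ (subst (λ k → Fin (size (Hs k))) (≟-sound j∈k) a)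

  induced-⨁-subsequence : ∃ λ (I : Fin (c * L) → Bool) → InducedIso G (bigUnion G I X) (⨁ c Hs)
  induced-⨁-subsequence with ∣ ⨁ c Hs ∣ᵥ ℕ.≟ 0
  ... | yes S≡0 =
    (λ _ → false) ,
    InducedIso-empty G {bigUnion G (λ _ → false) X} {⨁ c Hs} S≡0 (λ _ → any-const-false (allFin (c * L)))
  ... | no  S≢0 with σ , σ-class , σ-independent
                     ← transversal (λ k → size (Hs k) * b) blocks≤ (class-viable (n≢0⇒n>0 S≢0)) =
    _ , bigUnion-image G X σ {⨁ c Hs} (⨁-induced G c Hs (X ∘ σ) Xσ≅Hs
                               (separated-by-rank G (X ∘ σ) (toℕ ∘ σ) rank-inj σ-independent))
    where
    Xσ≅Hs : ∀ k → InducedIso G (X (σ k)) (Hs k)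
    Xσ≅Hs k = subst (InducedIso G (X (σ k)) ∘ Hs) (σ-class k) (X≅Hs (σ k))
    rank-inj : ∀ {k k′} → toℕ (σ k) ≡ toℕ (σ k′) → k ≡ k′
    rank-inj {k} {k′} e = trans (sym (σ-class k)) (trans (cong (modIdx c L) (toℕ-injective e)) (σ-class k′))

lemma12 : (G : Graph) (N : ℕ) → 1 < N → (c : ℕ) (Hs : Fin c → Graph)
    → (X : Fin (c * (∣ ⨁ c Hs ∣ᵥ * ⌈log₂ N ⌉)) → VSet G)
    → (∀ i → InducedIso G (X i) (Hs (modIdx c (∣ ⨁ c Hs ∣ᵥ * ⌈log₂ N ⌉) i)))
    → (∀ i v → X i v ≡ true
         → count (λ j → (toℕ j <ᵇ toℕ i) ∧ inClosedNbhd G (X j) v) ≤ ⌈log₂ N ⌉)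
    → ∃ λ (I : Fin (c * (∣ ⨁ c Hs ∣ᵥ * ⌈log₂ N ⌉)) → Bool)
         → InducedIso G (bigUnion G I X) (⨁ c Hs)
lemma12 G N 1<N c Hs X X≅Hs sparse = induced-⨁-subsequence G Hs 1≤log₂N X X≅Hs sparse
  where
  1≤log₂N : 1 ≤ ⌈log₂ N ⌉
  1≤log₂N = subst (_≤ ⌈log₂ N ⌉) (⌈log₂2^n⌉≡n 1) (⌈log₂⌉-mono-≤ 1<N)
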